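{- Let $\Omega$ be a region of $\mathcal{C}^*_{n,A}$, let $\mathbf{x}\in\Omega$ have associated permutation $\pi$, and let $p_\pi(\Omega)$ be the partition of $\pi$ defined below. For $i,j\in[n]$, the elements $i$ and $j$ are autonomous with respect to $P(\Omega)=(P_1,\dots,P_m)$ if and only if $i$ and $j$ lie in the same block of $p_\pi(\Omega)$.
   Context: Let $m\ge1$ and $A=\{a_1,\dots,a_m\}$ with $a_1>\cdots>a_m>0$ real. $\mathcal{C}^*_{n,A}$ is the arrangement in $\mathbb{R}^n$ of the hyperplanes $x_i-x_j=a_k$ ($i\neq j$ in $[n]$, $k\in[m]$); a region is a connected component of the complement of their union. For $\mathbf{x}\in\Omega$ and $k\in[m]$, $P_k$ is the poset on $[n]$ with $i\prec_{P_k} j$ iff $x_i<x_j-a_k$; it does not depend on the choice of $\mathbf{x}\in\Omega$. The associated permutation of $\mathbf{x}$ is the unique $\pi\in\mathfrak{S}_n$ with $x_{\pi(1)}\ge\cdots\ge x_{\pi(n)}$ and $\pi^{ -1}(i)<\pi^{ -1}(j)$ whenever $i<j$, $x_i=x_j$. $M_k$ is the $n\times n$ matrix with $(s,t)$ entry $\operatorname{sgn}(x_{\pi(s)}-x_{\pi(t)}-a_k)\in\{+,-\}$. Call positions $s,t\in[n]$ equivalent if for every $k\in[m]$ the $s$-th and $t$-th rows of $M_k$ contain the same number of $+$ entries and the $s$-th and $t$-th columns of $M_k$ contain the same number of $+$ entries; the equivalence classes consist of consecutive positions. The partition $p_\pi(\Omega)$ of the word $\pi=\pi(1)\pi(2)\cdots\pi(n)$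 has as blocks the subwords $\pi(s)\pi(s+1)\cdots\pi(s')$ for each equivalence class $\{s,\dots,s'\}$. (Equivalently, $p_\pi(\Omega)$ is the common refinement of the partitions of $\pi$ induced by the $m$ Dyck paths labeled by $\pi$ that separate the $+$ and $-$ entries of $M_1,\dots,M_m$.) For a poset $Q$ and $i\in Q$, $\Lambda_Q(i)=\{j: j<_Q i\}$ and $V_Q(i)=\{j: i<_Q j\}$; $i,j$ are autonomous with respect to $(P_1,\dots,P_m)$ if $\Lambda_{P_k}(i)=\Lambda_{P_k}(j)$ and $V_{P_k}(i)=V_{P_k}(j)$ for all $k\in[m]$. -}

module Defs where

open import Level using (0ℓ)
open import Data.Nat using (ℕ; suc)
open import Data.Fin as F using (Fin)
open import Data.Fin.Permutation using (Permutation′; _⟨$⟩ʳ_; _⟨$⟩ˡ_)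
open import Data.List using (List; length; filter)
open import Data.List using () renaming (allFin to allFinL)
open import Data.Product using (Σ; ∃; _×_; _,_)
open import Data.Sum using (_⊎_)
open import Relation.Nullary using (¬_)
open import Relation.Binary.PropositionalEquality using (_≡_; _≢_)
open import Relation.Binary.Structures using (IsStrictTotalOrder)
open import Algebra.Structures using (IsCommutativeRing)
open import Function.Bundles using (_⇔_)

-- The real numbers, axiomatised as a complete ordered field.
-- (Any two such structures are isomorphic, so quantifying over all of
-- them is the same as speaking about ℝ.)

record CompleteOrderedField : Set₁ where
  infixl 6 _+_ _-_
  infixl 7 _*_
  infix  8 -_
  infix  4 _<_ _≤_
  field
    Carrier : Set
    _+_ _*_ : Carrier → Carrier → Carrier
    -_      : Carrier → Carrier
    0# 1#   : Carrier
    isCommutativeRing : IsCommutativeRing _≡_ _+_ _*_ -_ 0# 1#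
    0≢1     : 0# ≢ 1#
    inverse : ∀ x → x ≢ 0# → Σ Carrier (λ y → x * y ≡ 1#)
    _<_     : Carrier → Carrier → Set
    isStrictTotalOrder : IsStrictTotalOrder _≡_ _<_
    +-mono-< : ∀ {x y} z → x < y → x + z < y + z
    *-pos    : ∀ {x y} → 0# < x → 0# < y → 0# < x * y

  _≤_ : Carrier → Carrier → Set
  x ≤ y = x < y ⊎ x ≡ y

  _-_ : Carrier → Carrier → Carrier
  x - y = x + (- y)

  field
    sup : (S : Carrier → Set) → Σ Carrier S →
          Σ Carrier (λ b → ∀ s → S s → s ≤ b) →
          Σ Carrier (λ u → (∀ s → S s → s ≤ u) ×
                           (∀ b → (∀ s → S s → s ≤ b) → u ≤ b))

  open IsStrictTotalOrder isStrictTotalOrder public using (_<?_)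

module Setup (ℝ : CompleteOrderedField) where
  open CompleteOrderedField ℝ

  IsDecreasingPositive : {m : ℕ} → (Fin m → Carrier) → Set
  IsDecreasingPositive {m} a =
    (∀ (k l : Fin m) → k F.< l → a l < a k) × (∀ (k : Fin m) → 0# < a k)

  InComplement : {n m : ℕ} → (Fin m → Carrier) → (Fin n → Carrier) → Set
  InComplement {n} {m} a x =
    ∀ (i j : Fin n) (k : Fin m) → i ≢ j → x i - x j ≢ a k

  Prec : {n m : ℕ} → (Fin m → Carrier) → (Fin n → Carrier) →
         Fin m → Fin n → Fin n → Set
  Prec a x k i j = x i < x j - a k

  IsAssociatedPerm : {n : ℕ} → (Fin n → Carrier) → Permutation′ n → Set
  IsAssociatedPerm {n} x π =
    (∀ (s t : Fin n) → s F.< t → x (π ⟨$⟩ʳ t) ≤ x (π ⟨$⟩ʳ s)) ×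
    (∀ (i j : Fin n) → i F.< j → x i ≡ x j → (π ⟨$⟩ˡ i) F.< (π ⟨$⟩ˡ j))

  -- (s,t) entry of M_k is + iff x_{π(s)} - x_{π(t)} - a_k > 0
  PlusEntry : {n m : ℕ} → (Fin m → Carrier) → (Fin n → Carrier) →
              Permutation′ n → Fin m → Fin n → Fin n → Set
  PlusEntry a x π k s t = 0# < x (π ⟨$⟩ʳ s) - x (π ⟨$⟩ʳ t) - a k

  rowPlus : {n m : ℕ} → (Fin m → Carrier) → (Fin n → Carrier) →
            Permutation′ n → Fin m → Fin n → ℕ
  rowPlus {n} a x π k s =
    length (filter (λ t → 0# <? x (π ⟨$⟩ʳ s) - x (π ⟨$⟩ʳ t) - a k) (allFinL n))

  colPlus : {n m : ℕ} → (Fin m → Carrier) → (Fin n → Carrier) →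
            Permutation′ n → Fin m → Fin n → ℕ
  colPlus {n} a x π k t =
    length (filter (λ s → 0# <? x (π ⟨$⟩ʳ s) - x (π ⟨$⟩ʳ t) - a k) (allFinL n))

  EquivPos : {n m : ℕ} → (Fin m → Carrier) → (Fin n → Carrier) →
             Permutation′ n → Fin n → Fin n → Set
  EquivPos {n} {m} a x π s t =
    ∀ (k : Fin m) → rowPlus a x π k s ≡ rowPlus a x π k t ×
                    colPlus a x π k s ≡ colPlus a x π k t

  -- i and j (elements of [n]) lie in the same block of p_π(Ω):
  -- their positions π⁻¹(i), π⁻¹(j) in the word π are equivalent
  SameBlock : {n m : ℕ} → (Fin m → Carrier) → (Fin n → Carrier) →
              Permutation′ n → Fin n → Fin n → Set
  SameBlock a x π i j = EquivPos a x π (π ⟨$⟩ˡ i) (π ⟨$⟩ˡ j)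

  -- i and j are autonomous w.r.t. (P_1,...,P_m):
  -- Λ_{P_k}(i) = Λ_{P_k}(j) and V_{P_k}(i) = V_{P_k}(j) for all k
  Autonomous : {n m : ℕ} → (Fin m → Carrier) → (Fin n → Carrier) →
               Fin n → Fin n → Set
  Autonomous {n} {m} a x i j =
    ∀ (k : Fin m) (l : Fin n) →
      (Prec a x k l i ⇔ Prec a x k l j) × (Prec a x k i l ⇔ Prec a x k j l)

-- The + entries of row s of M_k mark the elements of Λ_{P_k}(π(s)), those of column s the
-- elements of V_{P_k}(π(s)). Both sets are monotone in x_{π(s)}: Λ grows and V shrinks as it
-- increases. Hence for any two elements one Λ-set contains the other, and likewise the V-sets,
-- so equal cardinalities (equivalent positions) already force equal sets (autonomy).
module Submission where

open import Defs
open import Level using (0ℓ)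
open import Data.Nat using (ℕ; _≥_)
open import Data.Fin using (Fin)
open import Data.Fin.Permutation using (Permutation′; _⟨$⟩ʳ_; _⟨$⟩ˡ_; inverseʳ)
open import Data.List using (length; filter; allFin)
open import Data.List.Properties using (filter-≐)
open import Data.List.Membership.Propositional using (_∈_)
open import Data.List.Membership.Propositional.Properties using (∈-filter⁺; ∈-filter⁻; ∈-allFin)
open import Data.List.Relation.Binary.Pointwise using (Pointwise-≡⇒≡)
open import Data.List.Relation.Binary.Sublist.Propositional using (⊆-refl) renaming (_⊆_ to Sublist)
open import Data.List.Relation.Binary.Sublist.Propositional.Properties using (filter⁺)
open import Data.List.Relation.Binary.Sublist.Heterogeneous.Properties using (toPointwise)
open import Data.Product using (_,_; proj₁; proj₂)
open import Data.Sum using (_⊎_; inj₁; inj₂; [_,_]′)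
open import Function using (_∘_)
open import Function.Bundles using (_⇔_; mk⇔; Equivalence)
import Function.Properties.Equivalence as ⇔
open import Relation.Nullary using (Dec)
open import Relation.Unary using (Pred; Decidable; _⊆_)
open import Relation.Binary.PropositionalEquality using (_≡_; refl; sym; cong; subst; subst₂)
open import Relation.Binary.Definitions using (tri<; tri≈; tri>)
open import Relation.Binary.Structures using (IsStrictTotalOrder)
open import Algebra.Bundles using (CommutativeRing)
import Algebra.Properties.Group as GroupProperties
import Algebra.Properties.CommutativeSemigroup as CommutativeSemigroupProperties

open Equivalence using (to; from)

module _ {a p q} {A : Set a} {P : Pred A p} {Q : Pred A q}
         (P? : Decidable P) (Q? : Decidable Q) where

  length-filter-⇔ : (∀ x → P x ⇔ Q x) → ∀ xs → length (filter P? xs) ≡ length (filter Q? xs)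
  length-filter-⇔ P⇔Q xs = cong length (filter-≐ P? Q? (to (P⇔Q _) , from (P⇔Q _)) xs)

  length-filter-≡⇒⊇ : P ⊆ Q → ∀ {xs} → length (filter P? xs) ≡ length (filter Q? xs) →
                      ∀ {x} → x ∈ xs → Q x → P x
  length-filter-≡⇒⊇ P⊆Q {xs} eq {x} x∈xs Qx = proj₂ (∈-filter⁻ P? {xs = xs} x∈filterP)
    where
    filterP⊑filterQ : Sublist (filter P? xs) (filter Q? xs)
    filterP⊑filterQ = filter⁺ P? Q? {as = xs} (λ { refl → P⊆Q }) ⊆-refl

    filterP≡filterQ : filter P? xs ≡ filter Q? xs
    filterP≡filterQ = Pointwise-≡⇒≡ (toPointwise eq filterP⊑filterQ)

    x∈filterP : x ∈ filter P? xs
    x∈filterP = subst (x ∈_) (sym filterP≡filterQ) (∈-filter⁺ Q? x∈xs Qx)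

module _ (ℝ : CompleteOrderedField) where
  open CompleteOrderedField ℝ
  open Setup ℝ

  private
    commutativeRing : CommutativeRing 0ℓ 0ℓ
    commutativeRing = record { isCommutativeRing = isCommutativeRing }

  open CommutativeRing commutativeRing using (-‿inverseʳ; +-identityˡ; +-group; +-commutativeSemigroup)
  open GroupProperties +-group using (//-rightDividesˡ)
  open CommutativeSemigroupProperties +-commutativeSemigroup using (xy∙z≈xz∙y)
  open IsStrictTotalOrder isStrictTotalOrder using (compare) renaming (trans to <-trans)

  u<w⇒0<w-u : ∀ {u w} → u < w → 0# < w - u
  u<w⇒0<w-u {u} {w} u<w = subst (_< w - u) (-‿inverseʳ u) (+-mono-< (- u) u<w)

  0<w-u⇒u<w : ∀ {u w} → 0# < w - u → u < w
  0<w-u⇒u<w {u} {w} 0<w-u = subst₂ _<_ (+-identityˡ u) (//-rightDividesˡ u w) (+-mono-< u 0<w-u)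

  0<v-u-c⇔u<v-c : ∀ {u v c} → 0# < v - u - c ⇔ u < v - c
  0<v-u-c⇔u<v-c {u} {v} {c} =
    mk⇔ (0<w-u⇒u<w ∘ subst (0# <_) reorder) (subst (0# <_) (sym reorder) ∘ u<w⇒0<w-u)
    where
    reorder : v - u - c ≡ v - c - u
    reorder = xy∙z≈xz∙y v (- u) (- c)

  ≤-total : ∀ u w → u ≤ w ⊎ w ≤ u
  ≤-total u w with compare u w
  ... | tri< u<w _ _ = inj₁ (inj₁ u<w)
  ... | tri≈ _ u≡w _ = inj₁ (inj₂ u≡w)
  ... | tri> _ _ w<u = inj₂ (inj₁ w<u)

  module _ {n m : ℕ} (a : Fin m → Carrier) (x : Fin n → Carrier) where

    Λ-mono : ∀ {i j} → x i ≤ x j → ∀ {k l} → Prec a x k l i → Prec a x k l j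
    Λ-mono (inj₁ xi<xj) {k} l≺i = <-trans l≺i (+-mono-< (- a k) xi<xj)
    Λ-mono (inj₂ xi≡xj) {k} {l} = subst (λ z → x l < z - a k) xi≡xj

    V-antitone : ∀ {i j} → x i ≤ x j → ∀ {k l} → Prec a x k j l → Prec a x k i l
    V-antitone (inj₁ xi<xj) j≺l = <-trans xi<xj j≺l
    V-antitone (inj₂ xi≡xj) {k} {l} = subst (λ z → z < x l - a k) (sym xi≡xj)

    autonomous-sym : ∀ {i j} → Autonomous a x i j → Autonomous a x j i
    autonomous-sym aut k l = mk⇔ (from (proj₁ (aut k l))) (to (proj₁ (aut k l)))
                           , mk⇔ (from (proj₂ (aut k l))) (to (proj₂ (aut k l)))

    module _ (π : Permutation′ n) where

      plus? : ∀ k s t → Dec (PlusEntry a x π k s t)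
      plus? k s t = 0# <? x (π ⟨$⟩ʳ s) - x (π ⟨$⟩ʳ t) - a k

      plus⇔prec : ∀ {k s t} → PlusEntry a x π k s t ⇔ Prec a x k (π ⟨$⟩ʳ t) (π ⟨$⟩ʳ s)
      plus⇔prec = 0<v-u-c⇔u<v-c

      equivPos-sym : ∀ {s t} → EquivPos a x π s t → EquivPos a x π t s
      equivPos-sym eq k = sym (proj₁ (eq k)) , sym (proj₂ (eq k))

      positions⇒elements : ∀ {R : Fin n → Set} → (∀ t → R (π ⟨$⟩ʳ t)) → ∀ l → R l
      positions⇒elements {R} Rπ l = subst R (inverseʳ π) (Rπ (π ⟨$⟩ˡ l))

      autonomous⇒equivPos : ∀ {s t} → Autonomous a x (π ⟨$⟩ʳ s) (π ⟨$⟩ʳ t) → EquivPos a x π s t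
      autonomous⇒equivPos {s} {t} aut k =
          length-filter-⇔ (plus? k s) (plus? k t) rowsAgree (allFin n)
        , length-filter-⇔ (λ r → plus? k r s) (λ r → plus? k r t) colsAgree (allFin n)
        where
        rowsAgree : ∀ r → PlusEntry a x π k s r ⇔ PlusEntry a x π k t r
        rowsAgree r = ⇔.trans plus⇔prec (⇔.trans (proj₁ (aut k (π ⟨$⟩ʳ r))) (⇔.sym plus⇔prec))

        colsAgree : ∀ r → PlusEntry a x π k r s ⇔ PlusEntry a x π k r t
        colsAgree r = ⇔.trans plus⇔prec (⇔.trans (proj₂ (aut k (π ⟨$⟩ʳ r))) (⇔.sym plus⇔prec))

      equivPos⇒autonomous-≤ : ∀ {s t} → x (π ⟨$⟩ʳ s) ≤ x (π ⟨$⟩ʳ t) →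
                              EquivPos a x π s t → Autonomous a x (π ⟨$⟩ʳ s) (π ⟨$⟩ʳ t)
      equivPos⇒autonomous-≤ {s} {t} xs≤xt eq k l =
          mk⇔ (Λ-mono xs≤xt) (positions⇒elements Λt⊆Λs l)
        , mk⇔ (positions⇒elements Vs⊆Vt l) (V-antitone xs≤xt)
        where
        Λt⊆Λs : ∀ r → Prec a x k (π ⟨$⟩ʳ r) (π ⟨$⟩ʳ t) → Prec a x k (π ⟨$⟩ʳ r) (π ⟨$⟩ʳ s)
        Λt⊆Λs r = to plus⇔prec
                ∘ length-filter-≡⇒⊇ (plus? k s) (plus? k t)
                    (from plus⇔prec ∘ Λ-mono xs≤xt ∘ to plus⇔prec) (proj₁ (eq k)) (∈-allFin r)
                ∘ from plus⇔prec

        Vs⊆Vt : ∀ r → Prec a x k (π ⟨$⟩ʳ s) (π ⟨$⟩ʳ r) → Prec a x k (π ⟨$⟩ʳ t) (π ⟨$⟩ʳ r)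
        Vs⊆Vt r = to plus⇔prec
                ∘ length-filter-≡⇒⊇ (λ r′ → plus? k r′ t) (λ r′ → plus? k r′ s)
                    (from plus⇔prec ∘ V-antitone xs≤xt ∘ to plus⇔prec) (sym (proj₂ (eq k))) (∈-allFin r)
                ∘ from plus⇔prec

      equivPos⇒autonomous : ∀ {s t} → EquivPos a x π s t → Autonomous a x (π ⟨$⟩ʳ s) (π ⟨$⟩ʳ t)
      equivPos⇒autonomous {s} {t} eq =
        [ (λ xs≤xt → equivPos⇒autonomous-≤ xs≤xt eq)
        , (λ xt≤xs → autonomous-sym (equivPos⇒autonomous-≤ xt≤xs (equivPos-sym eq)))
        ]′ (≤-total (x (π ⟨$⟩ʳ s)) (x (π ⟨$⟩ʳ t)))

      autonomous⇔sameBlock : ∀ i j → Autonomous a x i j ⇔ SameBlock a x π i j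
      autonomous⇔sameBlock i j =
        subst₂ (λ i′ j′ → Autonomous a x i′ j′ ⇔ SameBlock a x π i j) (inverseʳ π) (inverseʳ π)
          (mk⇔ autonomous⇒equivPos equivPos⇒autonomous)

lemma2p4 : (ℝ : CompleteOrderedField) → let open Setup ℝ in
    (n m : ℕ) → m ≥ 1 → (a : Fin m → CompleteOrderedField.Carrier ℝ) → IsDecreasingPositive a →
    (x : Fin n → CompleteOrderedField.Carrier ℝ) → InComplement a x →
    (π : Permutation′ n) → IsAssociatedPerm x π →
    (i j : Fin n) → Autonomous a x i j ⇔ SameBlock a x π i j
lemma2p4 ℝ n m _ a _ x _ π _ = autonomous⇔sameBlock ℝ a x π
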